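{- Let $\rho$ be an inheritable basic hyperparameter. Then for every integer $c$ and every graph class $\mathcal G$: (1) if $\mathcal G$ has bounded $\mu_{\rho,c}$, then $\mathcal G$ has bounded $\rho$; (2) if $\mathcal G$ has bounded $\alpha\text{ - }\mu_{\rho,c}$, then $\mathcal G$ has bounded $\alpha\text{ - }\rho$; (3) if $\mathcal G$ has clique-bounded $\mu_{\rho,c}$, then $\mathcal G$ has clique-bounded $\rho$.
   Context: All graphs are finite, simple and undirected; $\alpha,\omega$ denote independence and clique number. A graph class is a set of graphs closed under isomorphism. A hypergraph over $G$ is a nonempty set of subsets of $V(G)$; a hypermapping $\mathcal F$ assigns to each graph $G$ a finite nonempty family $\mathcal F_G$ of hypergraphs over $G$, compatibly with isomorphisms. For $\lambda\in\{\mathtt{card},\alpha\}$ with $\mathtt{card}(G,X)=|X|$ and $\alpha(G,X)=\alpha(G[X])$, and a basic hyperparameter $\rho=(\mathrm{opt},\mathcal F)$ with $\mathrm{opt}\in\{\mathrm{minmax},\mathrm{maxmin}\}$, define $\lambda\text{ - }\rho(G)=\min_{H\in\mathcal F_G}\max_{X\in H}\lambda(G,X)$ if $\mathrm{opt}=\mathrm{minmax}$ and $\max_{H\in\mathcal F_G}\min_{X\in H}\lambda(G,X)$ if $\mathrm{opt}=\mathrm{maxmin}$; $\rho(G)=\mathtt{card}\text{ - }\rho(G)$. $\rho$ is inheritable if for each $\lambda\in\{\mathtt{card},\alpha\}$, every graph $G$ and every $S\subseteq V(G)$, $\lambda\text{ - }\rho(G)\le\rho(G-S)+\lambda(G,S)$.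 For an integer $c$, a $(\rho,c)$-modulator of $G$ is a set $S\subseteq V(G)$ with $\rho(G-S)\le c$; $\mu_{\rho,c}(G)$ is the minimum $|S|$ and $\alpha\text{ - }\mu_{\rho,c}(G)$ the minimum $\alpha(G[S])$ over all $(\rho,c)$-modulators $S$. A class $\mathcal G$ has bounded $\sigma$ if there is an integer $k$ with $\sigma(G')\le k$ for every induced subgraph $G'$ of every $G\in\mathcal G$; it has clique-bounded $\sigma$ if there is a nondecreasing $f$ with $\sigma(G')\le f(\omega(G'))$ for all such $G'$. -}

module Defs where

open import Data.Nat using (ℕ; zero; suc; _≤_; _⊔_; _⊓_)
open import Data.Integer as ℤ using (ℤ; +_)
open import Data.Bool using (Bool; true; false; not; _∧_; if_then_else_)
open import Data.Fin using (Fin; zero; suc)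
import Data.Fin as Fin
open import Data.Fin.Subset using (Subset; ∁)
open import Data.Vec using (Vec; []; _∷_; lookup; tabulate)
open import Data.List as List using (List; []; _∷_; _++_; allFin; filterᵇ)
open import Data.List.NonEmpty as List⁺ using (List⁺; _∷_; toList)
open import Data.List.Membership.Propositional using (_∈_)
open import Data.Maybe using (Maybe; just; nothing)
open import Data.Product using (Σ; ∃; _×_; _,_)
open import Data.Empty using (⊥)
open import Function using (_∘_)
open import Function.Bundles using (_↔_; Inverse; _⇔_)
open import Relation.Binary.PropositionalEquality using (_≡_; refl; cong)
open import Relation.Nullary.Decidable using (⌊_⌋)

record Graph : Set where
  field
    n      : ℕ
    adj    : Fin n → Fin n → Bool
    sym    : ∀ i j → adj i j ≡ adj j i
    irrefl : ∀ i → adj i i ≡ false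
open Graph public

V : Graph → Set
V G = Fin (n G)

size : ∀ {m} → Subset m → ℕ
size []           = 0
size (true  ∷ X)  = suc (size X)
size (false ∷ X)  = size X

emb : ∀ {m} (X : Subset m) → Fin (size X) → Fin m
emb (true  ∷ X) zero    = zero
emb (true  ∷ X) (suc i) = suc (emb X i)
emb (false ∷ X) i       = suc (emb X i)

induced : (G : Graph) → Subset (n G) → Graph
induced G X = record
  { n      = size X
  ; adj    = λ i j → adj G (emb X i) (emb X j)
  ; sym    = λ i j → sym G (emb X i) (emb X j)
  ; irrefl = λ i → irrefl G (emb X i)
  }

_─_ : (G : Graph) → Subset (n G) → Graph
G ─ S = induced G (∁ S)

allSubsets : (m : ℕ) → List (Subset m)
allSubsets zero    = [] ∷ []
allSubsets (suc m) = List.map (true ∷_) (allSubsets m) ++ List.map (false ∷_) (allSubsets m)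

allB : ∀ {A : Set} → (A → Bool) → List A → Bool
allB p = List.foldr (λ x b → p x ∧ b) true

maxL : List ℕ → ℕ
maxL = List.foldr _⊔_ 0

isIndependent : (G : Graph) → Subset (n G) → Bool
isIndependent G X =
  allB (λ i → allB (λ j → not (lookup X i ∧ lookup X j ∧ adj G i j)) (allFin (n G))) (allFin (n G))

isClique : (G : Graph) → Subset (n G) → Bool
isClique G X =
  allB (λ i → allB (λ j → not (lookup X i ∧ lookup X j ∧ not ⌊ i Fin.≟ j ⌋ ∧ not (adj G i j)))
                 (allFin (n G))) (allFin (n G))

α : Graph → ℕ
α G = maxL (List.map (λ X → if isIndependent G X then size X else 0) (allSubsets (n G)))

ω : Graph → ℕ
ω G = maxL (List.map (λ X → if isClique G X then size X else 0) (allSubsets (n G)))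

record Iso (G H : Graph) : Set where
  field
    bij      : V G ↔ V H
    preserve : ∀ i j → adj G i j ≡ adj H (Inverse.to bij i) (Inverse.to bij j)

imageSubset : ∀ {G H} → Iso G H → Subset (n G) → Subset (n H)
imageSubset φ X = tabulate (λ j → lookup X (Inverse.from (Iso.bij φ) j))

Hypergraph : Graph → Set
Hypergraph G = List⁺ (Subset (n G))

Family : Graph → Set
Family G = List⁺ (Hypergraph G)

SameHyp : ∀ {m} → List⁺ (Subset m) → List⁺ (Subset m) → Set
SameHyp A B = ∀ X → (X ∈ toList A) ⇔ (X ∈ toList B)

SameFam : ∀ {m} → List⁺ (List⁺ (Subset m)) → List⁺ (List⁺ (Subset m)) → Set
SameFam 𝒜 ℬ =
  (∀ A → A ∈ toList 𝒜 → ∃ λ B → B ∈ toList ℬ × SameHyp A B) ×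
  (∀ B → B ∈ toList ℬ → ∃ λ A → A ∈ toList 𝒜 × SameHyp A B)

imageFamily : ∀ {G H} → Iso G H → Family G → Family H
imageFamily φ = List⁺.map (List⁺.map (imageSubset φ))

record Hypermapping : Set where
  field
    F      : (G : Graph) → Family G
    compat : ∀ G H (φ : Iso G H) → SameFam (F H) (imageFamily φ (F G))
open Hypermapping public

data Opt : Set where
  minmax maxmin : Opt

record BasicHyperparameter : Set where
  constructor ⟨_,_⟩
  field
    opt : Opt
    ℱ   : Hypermapping
open BasicHyperparameter public

data Measure : Set where
  card alpha : Measure

measure : Measure → (G : Graph) → Subset (n G) → ℕ
measure card  G X = size X
measure alpha G X = α (induced G X)

max⁺ : List⁺ ℕ → ℕ
max⁺ = List⁺.foldr₁ _⊔_

min⁺ : List⁺ ℕ → ℕ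
min⁺ = List⁺.foldr₁ _⊓_

_-ρ_ : Measure → BasicHyperparameter → Graph → ℕ
(λ' -ρ ρ) G with opt ρ
... | minmax = min⁺ (List⁺.map (λ H → max⁺ (List⁺.map (measure λ' G) H)) (F (ℱ ρ) G))
... | maxmin = max⁺ (List⁺.map (λ H → min⁺ (List⁺.map (measure λ' G) H)) (F (ℱ ρ) G))

val : BasicHyperparameter → Graph → ℕ
val ρ = card -ρ ρ

Inheritable : BasicHyperparameter → Set
Inheritable ρ = ∀ (λ' : Measure) (G : Graph) (S : Subset (n G)) →
  (λ' -ρ ρ) G ≤ val ρ (G ─ S) Data.Nat.+ measure λ' G S

-- modulators and μ (with value "∞" = nothing when no modulator exists)

isModulator : BasicHyperparameter → ℤ → (G : Graph) → Subset (n G) → Bool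
isModulator ρ c G S = ⌊ (+ val ρ (G ─ S)) ℤ.≤? c ⌋

minMaybe : List ℕ → Maybe ℕ
minMaybe []       = nothing
minMaybe (x ∷ xs) with minMaybe xs
... | nothing = just x
... | just y  = just (x ⊓ y)

-- μ_{ρ,c} (λ' = card) and α-μ_{ρ,c} (λ' = alpha)
μ : Measure → BasicHyperparameter → ℤ → Graph → Maybe ℕ
μ λ' ρ c G = minMaybe (List.map (measure λ' G) (filterᵇ (isModulator ρ c G) (allSubsets (n G))))

record GraphClass : Set₁ where
  field
    _∈𝒢    : Graph → Set
    closed : ∀ G H → Iso G H → G ∈𝒢 → H ∈𝒢
open GraphClass public

-- extended-natural comparison: ∞ (nothing) is below no integer
_≤∞_ : Maybe ℕ → ℕ → Set
just m  ≤∞ k = m ≤ k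
nothing ≤∞ k = ⊥

Bounded : GraphClass → (Graph → Maybe ℕ) → Set
Bounded 𝒢 σ = ∃ λ (k : ℕ) → ∀ G → (𝒢 ∈𝒢) G → ∀ (X : Subset (n G)) → σ (induced G X) ≤∞ k

CliqueBounded : GraphClass → (Graph → Maybe ℕ) → Set
CliqueBounded 𝒢 σ = ∃ λ (f : ℕ → ℕ) → (∀ a b → a ≤ b → f a ≤ f b) ×
  (∀ G → (𝒢 ∈𝒢) G → ∀ (X : Subset (n G)) → σ (induced G X) ≤∞ f (ω (induced G X)))

finite : (Graph → ℕ) → Graph → Maybe ℕ
finite σ G = just (σ G)

-- Take a minimum (ρ,c)-modulator S of G, of λ-measure μ. Inheritability gives
-- λ-ρ(G) ≤ ρ(G − S) + λ(G,S) ≤ c + μ, so any bound on μ over the induced subgraphs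
-- of a class — a constant, or a nondecreasing function of ω — shifted by c bounds λ-ρ.
module Submission where

open import Defs
open import Data.Integer using (ℤ)
open import Data.Bool using (T)
open import Data.Fin.Subset using (Subset)
import Data.Integer as ℤ
open import Data.List using (List; _∷_; map; filterᵇ)
open import Data.List.Membership.Propositional using (_∈_)
open import Data.List.Membership.Propositional.Properties using (∈-map⁻; ∈-filter⁻)
open import Data.List.Relation.Unary.Any using (here; there)
open import Data.Maybe using (Maybe; just; nothing)
open import Data.Nat using (ℕ; _≤_; _+_)
open import Data.Nat.Properties using (≤-trans; +-mono-≤; +-monoʳ-≤; ⊓-sel)
open import Data.Product using (∃; _×_; _,_; proj₂)
open import Data.Sum using (inj₁; inj₂)
open import Relation.Binary.PropositionalEquality using (_≡_; refl; subst) renaming (sym to ≡-sym)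
open import Relation.Nullary.Decidable using (toWitness)

minMaybe-attained : ∀ {xs : List ℕ} {m : ℕ} → minMaybe xs ≡ just m → m ∈ xs
minMaybe-attained {x ∷ xs} eq with minMaybe xs in min-xs
... | nothing with refl ← eq = here refl
... | just y with refl ← eq with ⊓-sel x y
...   | inj₁ x⊓y≡x = here x⊓y≡x
...   | inj₂ x⊓y≡y = there (subst (_∈ xs) (≡-sym x⊓y≡y) (minMaybe-attained min-xs))

modulators : BasicHyperparameter → ℤ → (G : Graph) → List (Subset (n G))
modulators ρ c G = filterᵇ (isModulator ρ c G) (allSubsets (n G))

μ-attained : ∀ λ' ρ c G {m} → μ λ' ρ c G ≡ just m →
  ∃ λ (S : Subset (n G)) → T (isModulator ρ c G S) × m ≡ measure λ' G S
μ-attained λ' ρ c G eq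
  with ∈-map⁻ (measure λ' G) (minMaybe-attained {map (measure λ' G) (modulators ρ c G)} eq)
... | S , S∈modulators , m≡λS = S , proj₂ (∈-filter⁻ _ {xs = allSubsets (n G)} S∈modulators) , m≡λS

+≤⇒≤∣∣ : ∀ {m : ℕ} {c : ℤ} → ℤ.+ m ℤ.≤ c → m ≤ ℤ.∣ c ∣
+≤⇒≤∣∣ (ℤ.+≤+ m≤c) = m≤c

modulator⇒val≤∣c∣ : ∀ ρ c G (S : Subset (n G)) → T (isModulator ρ c G S) → val ρ (G ─ S) ≤ ℤ.∣ c ∣
modulator⇒val≤∣c∣ ρ c G S isMod = +≤⇒≤∣∣ (toWitness isMod)

-ρ≤∣c∣+μ : ∀ ρ → Inheritable ρ → ∀ c λ' G (k : ℕ) → μ λ' ρ c G ≤∞ k → (λ' -ρ ρ) G ≤ ℤ.∣ c ∣ + k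
-ρ≤∣c∣+μ ρ inh c λ' G k μ≤k with μ λ' ρ c G in μ≡m
... | just m with μ-attained λ' ρ c G μ≡m
...   | S , isMod , refl =
  ≤-trans (inh λ' G S) (+-mono-≤ (modulator⇒val≤∣c∣ ρ c G S isMod) μ≤k)

bounded-shift : ∀ (𝒢 : GraphClass) {σ : Graph → Maybe ℕ} {τ : Graph → ℕ} (d : ℕ) →
  (∀ G k → σ G ≤∞ k → τ G ≤ d + k) → Bounded 𝒢 σ → Bounded 𝒢 (finite τ)
bounded-shift 𝒢 d τ≤d+σ (k , σ≤k) = d + k , λ G G∈𝒢 X → τ≤d+σ (induced G X) k (σ≤k G G∈𝒢 X)

cliqueBounded-shift : ∀ (𝒢 : GraphClass) {σ : Graph → Maybe ℕ} {τ : Graph → ℕ} (d : ℕ) →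
  (∀ G k → σ G ≤∞ k → τ G ≤ d + k) → CliqueBounded 𝒢 σ → CliqueBounded 𝒢 (finite τ)
cliqueBounded-shift 𝒢 d τ≤d+σ (f , f-mono , σ≤f∘ω) =
  (λ w → d + f w) ,
  (λ a b a≤b → +-monoʳ-≤ d (f-mono a b a≤b)) ,
  λ G G∈𝒢 X → τ≤d+σ (induced G X) _ (σ≤f∘ω G G∈𝒢 X)

theorem5p17 : (ρ : BasicHyperparameter) → Inheritable ρ → (c : ℤ) (𝒢 : GraphClass) →
    (Bounded 𝒢 (μ card ρ c) → Bounded 𝒢 (finite (card -ρ ρ))) ×
    (Bounded 𝒢 (μ alpha ρ c) → Bounded 𝒢 (finite (alpha -ρ ρ))) ×
    (CliqueBounded 𝒢 (μ card ρ c) → CliqueBounded 𝒢 (finite (card -ρ ρ)))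
theorem5p17 ρ inh c 𝒢 =
  bounded-shift 𝒢 ℤ.∣ c ∣ (-ρ≤∣c∣+μ ρ inh c card) ,
  bounded-shift 𝒢 ℤ.∣ c ∣ (-ρ≤∣c∣+μ ρ inh c alpha) ,
  cliqueBounded-shift 𝒢 ℤ.∣ c ∣ (-ρ≤∣c∣+μ ρ inh c card)
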